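{- Let $p\ge5$ be a prime and $\mathsf{A}=\prod_{i=1}^r\mathsf{A}_i$ a finite product of local commutative $\mathbb{F}_p$-algebras. Then $\mathsf{A}$ is spanned, as an $\mathbb{F}_p$-vector space, by the squares of its invertible elements. -}

module Defs where

open import Level using (Level; _⊔_)
open import Algebra.Bundles using (CommutativeRing)
open import Algebra.Structures using (IsCommutativeRing)
import Algebra.Definitions.RawMonoid as RawMonoidDefs
open import Data.Nat.Base using (ℕ)
open import Data.Fin.Base using (Fin; toℕ)
open import Data.Product.Base using (Σ; ∃; _×_; _,_)
open import Data.Sum.Base using (_⊎_)
open import Relation.Nullary using (¬_)

private
  variable
    c ℓ : Level

IsUnit : (R : CommutativeRing c ℓ) → CommutativeRing.Carrier R → Set (c ⊔ ℓ)
IsUnit R x = Σ Carrier λ y → (x * y) ≈ 1#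
  where open CommutativeRing R

-- Local commutative ring (same definition as Mathlib's LocalRing):
-- nontrivial, and whenever a + b = 1, a or b is a unit.
-- (Classically equivalent to having a unique maximal ideal.)
IsLocal : (R : CommutativeRing c ℓ) → Set (c ⊔ ℓ)
IsLocal R = (¬ (1# ≈ 0#)) × (∀ a b → (a + b) ≈ 1# → IsUnit R a ⊎ IsUnit R b)
  where open CommutativeRing R

-- R is an F_p-algebra: the (unique) ring map ℤ → R kills p,
-- i.e. p · 1 = 0 in R; then F_p = ℤ/p acts on R by n · x.
IsFpAlgebra : ℕ → (R : CommutativeRing c ℓ) → Set ℓ
IsFpAlgebra p R = (p ×ₙ 1#) ≈ 0#
  where
    open CommutativeRing R
    open RawMonoidDefs +-rawMonoid renaming (_×_ to _×ₙ_)

-- Scalars c_j ∈ F_p are represented by Fin p acting via n · x.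
SpannedBySquaresOfUnits : ℕ → (R : CommutativeRing c ℓ) → Set (c ⊔ ℓ)
SpannedBySquaresOfUnits p R =
  ∀ x → Σ ℕ λ n → Σ (Fin n → Fin p) λ coeff → Σ (Fin n → Carrier) λ u →
    (∀ j → IsUnit R (u j)) × (x ≈ sum (λ j → toℕ (coeff j) ×ₙ (u j * u j)))
  where
    open CommutativeRing R
    open RawMonoidDefs +-rawMonoid renaming (_×_ to _×ₙ_)

Π-ring : (r : ℕ) → (Fin r → CommutativeRing c ℓ) → CommutativeRing c ℓ
Π-ring r A = record
  { Carrier = (i : Fin r) → C i
  ; _≈_ = λ f g → ∀ i → M._≈_ i (f i) (g i)
  ; _+_ = λ f g i → M._+_ i (f i) (g i)
  ; _*_ = λ f g i → M._*_ i (f i) (g i)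
  ; -_ = λ f i → M.-_ i (f i)
  ; 0# = λ i → M.0# i
  ; 1# = λ i → M.1# i
  ; isCommutativeRing = record
    { isRing = record
      { +-isAbelianGroup = record
        { isGroup = record
          { isMonoid = record
            { isSemigroup = record
              { isMagma = record
                { isEquivalence = record
                  { refl = λ {f} i → M.refl i
                  ; sym = λ p i → M.sym i (p i)
                  ; trans = λ p q i → M.trans i (p i) (q i)
                  }
                ; ∙-cong = λ p q i → M.+-cong i (p i) (q i)
                }
              ; assoc = λ f g h i → M.+-assoc i (f i) (g i) (h i)
              }
            ; identity = (λ f i → M.+-identityˡ i (f i)) , (λ f i → M.+-identityʳ i (f i))
            }
          ; inverse = (λ f i → M.-‿inverseˡ i (f i)) , (λ f i → M.-‿inverseʳ i (f i))
          ; ⁻¹-cong = λ p i → M.-‿cong i (p i)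
          }
        ; comm = λ f g i → M.+-comm i (f i) (g i)
        }
      ; *-cong = λ p q i → M.*-cong i (p i) (q i)
      ; *-assoc = λ f g h i → M.*-assoc i (f i) (g i) (h i)
      ; *-identity = (λ f i → M.*-identityˡ i (f i)) , (λ f i → M.*-identityʳ i (f i))
      ; distrib = (λ f g h i → M.distribˡ i (f i) (g i) (h i)) , (λ f g h i → M.distribʳ i (f i) (g i) (h i))
      }
    ; *-comm = λ f g i → M.*-comm i (f i) (g i)
    }
  }
  where
    module M (i : Fin r) = CommutativeRing (A i)
    C : Fin r → Set _
    C i = CommutativeRing.Carrier (A i)

{-# OPTIONS --safe #-}
-- In a local ring the non-units form an ideal, and in an F_p-algebra with p ≥ 5 the
-- integers 1, 2, 3, 4 are units. So for every b at most one of b + 1, …, b + 4 is a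
-- non-unit, and some z ∈ {1, 2, 3} makes z, 1 + z, b + z and b + 1 + z all units.
-- Writing a = 2b, the identity
--   (b + 1 + z)² − (b + z)² + z² − (1 + z)² = 2b
-- then expresses a with the coefficients 1, −1, 1, −1. These do not depend on the
-- factor, so the representations in the factors assemble into one in the product.
module Submission where

open import Defs
open import Algebra.Bundles using (CommutativeRing)
open import Data.Nat.Base using (ℕ; _≤_)
open import Data.Nat.Primality using (Prime)
open import Data.Fin.Base using (Fin)

import Algebra.Definitions.RawMonoid as RawMonoidDefs
import Algebra.Properties.CommutativeSemigroup as CommutativeSemigroupProperties
import Algebra.Properties.Monoid.Mult as MonoidMult
import Algebra.Properties.Monoid.Sum as MonoidSum
import Algebra.Properties.Ring as RingProperties
import Algebra.Properties.Semiring.Mult as SemiringMult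
import Algebra.Solver.Ring.NaturalCoefficients.Default as NaturalSolver
open import Data.Fin.Base using (zero; suc; toℕ; fromℕ)
open import Data.Fin.Properties using (toℕ-fromℕ)
open import Data.Nat.Base as ℕ using (s≤s; z≤n)
open import Data.Nat.Coprimality using (Coprime; coprime-Bézout; prime⇒coprime)
open import Data.Nat.GCD using (module Bézout)
open import Data.Nat.Properties using (≤-trans)
open import Data.Product.Base using (Σ; _×_; _,_; proj₁; proj₂)
open import Data.Sum.Base using (_⊎_; inj₁; inj₂; map; map₁)
open import Data.Vec.Functional using (Vector; []; _∷_; tail)
open import Function.Base using (_∘_)
open import Level using (_⊔_)
import Relation.Binary.PropositionalEquality as ≡
import Relation.Binary.Reasoning.Setoid as SetoidReasoning

-- 1, -1, 1, -1 as elements of F_p = Fin (2 + m).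
signs : ∀ m → Vector (Fin (2 ℕ.+ m)) 4
signs m = suc zero ∷ fromℕ (ℕ.suc m) ∷ suc zero ∷ fromℕ (ℕ.suc m) ∷ []

module _ {c ℓ} (R : CommutativeRing c ℓ) where

  open CommutativeRing R
  open RawMonoidDefs +-rawMonoid using (sum) renaming (_×_ to _×ₙ_)
  open MonoidMult +-monoid using (×-congʳ; ×-congˡ; ×-homo-+)
  open SemiringMult semiring using (×-assoc-*; ×1-homo-*)
  open CommutativeSemigroupProperties *-commutativeSemigroup using (interchange)
  open RingProperties ring using (-‿distribˡ-*; -‿distribʳ-*; -‿involutive; +-inverseʳ-unique; xyx⁻¹≈y)
  open SetoidReasoning setoid
  open NaturalSolver commutativeSemiring using (solve; _:=_; _:+_; _:*_; con)

  isUnit-resp-≈ : ∀ {x y} → x ≈ y → IsUnit R x → IsUnit R y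
  isUnit-resp-≈ x≈y (x⁻¹ , xx⁻¹≈1) = x⁻¹ , trans (*-cong (sym x≈y) refl) xx⁻¹≈1

  isUnit-* : ∀ {x y} → IsUnit R x → IsUnit R y → IsUnit R (x * y)
  isUnit-* {x} {y} (x⁻¹ , xx⁻¹≈1) (y⁻¹ , yy⁻¹≈1) = x⁻¹ * y⁻¹ , (begin
    (x * y) * (x⁻¹ * y⁻¹) ≈⟨ interchange x y x⁻¹ y⁻¹ ⟩
    (x * x⁻¹) * (y * y⁻¹) ≈⟨ *-cong xx⁻¹≈1 yy⁻¹≈1 ⟩
    1# * 1#               ≈⟨ *-identityˡ 1# ⟩
    1#                    ∎)

  isUnit[x*y]⇒isUnit[x] : ∀ {x y} → IsUnit R (x * y) → IsUnit R x
  isUnit[x*y]⇒isUnit[x] {x} {y} (g , xyg≈1) = y * g , trans (sym (*-assoc x y g)) xyg≈1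

  isUnit[-x]⇒isUnit[x] : ∀ {x} → IsUnit R (- x) → IsUnit R x
  isUnit[-x]⇒isUnit[x] {x} (g , -xg≈1) = - g , (begin
    x * - g   ≈⟨ -‿distribʳ-* x g ⟨
    - (x * g) ≈⟨ -‿distribˡ-* x g ⟩
    - x * g   ≈⟨ -xg≈1 ⟩
    1#        ∎)

  local⇒isUnit[x+d]⊎isUnit[x] : IsLocal R → ∀ {d} → IsUnit R d → ∀ x → IsUnit R (x + d) ⊎ IsUnit R x
  local⇒isUnit[x+d]⊎isUnit[x] (_ , local) {d} (d⁻¹ , dd⁻¹≈1) x =
    map isUnit[x*y]⇒isUnit[x] (isUnit[-x]⇒isUnit[x] ∘ isUnit[x*y]⇒isUnit[x])
      (local ((x + d) * d⁻¹) (- x * d⁻¹) (begin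
        (x + d) * d⁻¹ + - x * d⁻¹ ≈⟨ distribʳ d⁻¹ (x + d) (- x) ⟨
        ((x + d) + - x) * d⁻¹     ≈⟨ *-cong (xyx⁻¹≈y x d) refl ⟩
        d * d⁻¹                   ≈⟨ dd⁻¹≈1 ⟩
        1#                        ∎))

  char⇒[k*p]×1#≈0# : ∀ {p} → IsFpAlgebra p R → ∀ k → (k ℕ.* p) ×ₙ 1# ≈ 0#
  char⇒[k*p]×1#≈0# {p} fp k = begin
    (k ℕ.* p) ×ₙ 1#        ≈⟨ ×1-homo-* k p ⟩
    (k ×ₙ 1#) * (p ×ₙ 1#)  ≈⟨ *-cong refl fp ⟩
    (k ×ₙ 1#) * 0#         ≈⟨ zeroʳ (k ×ₙ 1#) ⟩
    0#                     ∎

  char⇒×≈0# : ∀ {p} → IsFpAlgebra p R → ∀ x → p ×ₙ x ≈ 0#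
  char⇒×≈0# {p} fp x = begin
    p ×ₙ x         ≈⟨ ×-congʳ p (*-identityˡ x) ⟨
    p ×ₙ (1# * x)  ≈⟨ ×-assoc-* p 1# x ⟨
    (p ×ₙ 1#) * x  ≈⟨ *-cong fp refl ⟩
    0# * x         ≈⟨ zeroˡ x ⟩
    0#             ∎

  -- A Bézout identity for n and p becomes an inverse of n in R.
  coprime⇒isUnit : ∀ {p n} → IsFpAlgebra p R → Coprime p n → IsUnit R (n ×ₙ 1#)
  coprime⇒isUnit {p} {n} fp p⊥n with coprime-Bézout p⊥n
  ... | Bézout.-+ x y 1+xp≡yn = y ×ₙ 1# , (begin
    (n ×ₙ 1#) * (y ×ₙ 1#)  ≈⟨ *-comm (n ×ₙ 1#) (y ×ₙ 1#) ⟩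
    (y ×ₙ 1#) * (n ×ₙ 1#)  ≈⟨ ×1-homo-* y n ⟨
    (y ℕ.* n) ×ₙ 1#        ≡⟨ ≡.cong (_×ₙ 1#) 1+xp≡yn ⟨
    1# + (x ℕ.* p) ×ₙ 1#   ≈⟨ +-cong refl (char⇒[k*p]×1#≈0# fp x) ⟩
    1# + 0#                ≈⟨ +-identityʳ 1# ⟩
    1#                     ∎)
  ... | Bézout.+- x y 1+yn≡xp = isUnit[-x]⇒isUnit[x] (y ×ₙ 1# , (begin
    - (n ×ₙ 1#) * (y ×ₙ 1#)    ≈⟨ -‿distribˡ-* (n ×ₙ 1#) (y ×ₙ 1#) ⟨
    - ((n ×ₙ 1#) * (y ×ₙ 1#))  ≈⟨ -‿cong (*-comm (n ×ₙ 1#) (y ×ₙ 1#)) ⟩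
    - ((y ×ₙ 1#) * (n ×ₙ 1#))  ≈⟨ -‿cong yn≈-1 ⟩
    - (- 1#)                   ≈⟨ -‿involutive 1# ⟩
    1#                         ∎))
    where
    yn≈-1 : (y ×ₙ 1#) * (n ×ₙ 1#) ≈ - 1#
    yn≈-1 = +-inverseʳ-unique 1# _ (begin
      1# + (y ×ₙ 1#) * (n ×ₙ 1#)  ≈⟨ +-cong refl (×1-homo-* y n) ⟨
      1# + (y ℕ.* n) ×ₙ 1#        ≡⟨ ≡.cong (_×ₙ 1#) 1+yn≡xp ⟩
      (x ℕ.* p) ×ₙ 1#             ≈⟨ char⇒[k*p]×1#≈0# fp x ⟩
      0#                          ∎)

  prime⇒isUnit : ∀ {p n} .{{_ : ℕ.NonZero n}} → IsFpAlgebra p R → Prime p → n ℕ.< p →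
    IsUnit R (n ×ₙ 1#)
  prime⇒isUnit fp p-prime n<p = coprime⇒isUnit fp (prime⇒coprime p-prime n<p)

  record UnitShift (b : Carrier) : Set (c ⊔ ℓ) where
    constructor mkUnitShift
    field
      z             : Carrier
      isUnit[z]     : IsUnit R z
      isUnit[1+z]   : IsUnit R (1# + z)
      isUnit[b+z]   : IsUnit R (b + z)
      isUnit[b+1+z] : IsUnit R (b + (1# + z))

  module _ (isLocal : IsLocal R) (u₂ : IsUnit R (2 ×ₙ 1#)) (u₃ : IsUnit R (3 ×ₙ 1#)) (b : Carrier) where

    private
      u₁ : IsUnit R (1 ×ₙ 1#)
      u₁ = isUnit-resp-≈ (sym (+-identityʳ 1#)) (1# , *-identityˡ 1#)

      u₄ : IsUnit R (4 ×ₙ 1#)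
      u₄ = isUnit-resp-≈ (sym (×1-homo-* 2 2)) (isUnit-* u₂ u₂)

      apart : ∀ d k → IsUnit R (d ×ₙ 1#) → IsUnit R (b + (d ℕ.+ k) ×ₙ 1#) ⊎ IsUnit R (b + k ×ₙ 1#)
      apart d k u = map₁ (isUnit-resp-≈ b+k+d≈b+[d+k]) (local⇒isUnit[x+d]⊎isUnit[x] isLocal u (b + k ×ₙ 1#))
        where
        b+k+d≈b+[d+k] : (b + k ×ₙ 1#) + d ×ₙ 1# ≈ b + (d ℕ.+ k) ×ₙ 1#
        b+k+d≈b+[d+k] = begin
          (b + k ×ₙ 1#) + d ×ₙ 1#  ≈⟨ +-assoc b (k ×ₙ 1#) (d ×ₙ 1#) ⟩
          b + (k ×ₙ 1# + d ×ₙ 1#)  ≈⟨ +-cong refl (+-comm (k ×ₙ 1#) (d ×ₙ 1#)) ⟩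
          b + (d ×ₙ 1# + k ×ₙ 1#)  ≈⟨ +-cong refl (×-homo-+ 1# d k) ⟨
          b + (d ℕ.+ k) ×ₙ 1#      ∎

    local⇒unitShift : UnitShift b
    local⇒unitShift with apart 1 1 u₁
    ... | inj₁ c₂ with apart 2 1 u₂
    ...   | inj₁ c₃ = mkUnitShift (2 ×ₙ 1#) u₂ u₃ c₂ c₃
    ...   | inj₂ c₁ = mkUnitShift (1 ×ₙ 1#) u₁ u₂ c₁ c₂
    local⇒unitShift | inj₂ c₁ with apart 1 2 u₁
    ...   | inj₂ c₂ = mkUnitShift (1 ×ₙ 1#) u₁ u₂ c₁ c₂
    ...   | inj₁ c₃ with apart 2 2 u₂
    ...     | inj₁ c₄ = mkUnitShift (3 ×ₙ 1#) u₃ u₄ c₃ c₄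
    ...     | inj₂ c₂ = mkUnitShift (2 ×ₙ 1#) u₂ u₃ c₂ c₃

  isUnit[2]⇒half : IsUnit R (2 ×ₙ 1#) → ∀ a → Σ Carrier λ b → a ≈ b + b
  isUnit[2]⇒half (h , 2h≈1) a = h * a , (begin
    a                      ≈⟨ *-identityˡ a ⟨
    1# * a                 ≈⟨ *-cong 2h≈1 refl ⟨
    ((2 ×ₙ 1#) * h) * a    ≈⟨ solve 2 (λ h a → ((con 1 :+ (con 1 :+ con 0)) :* h) :* a := (h :* a) :+ (h :* a)) refl h a ⟩
    h * a + h * a          ∎)

  [b+1+z]²+z²≈[b+z]²+[1+z]²+2b : ∀ b z →
    (b + (1# + z)) * (b + (1# + z)) + z * z ≈ ((b + z) * (b + z) + (1# + z) * (1# + z)) + (b + b)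
  [b+1+z]²+z²≈[b+z]²+[1+z]²+2b = solve 2 (λ b z →
    ((b :+ (con 1 :+ z)) :* (b :+ (con 1 :+ z))) :+ (z :* z)
      := (((b :+ z) :* (b :+ z)) :+ ((con 1 :+ z) :* (con 1 :+ z))) :+ (b :+ b)) refl

  x+y≈u+v+w⇒x+u′+y+v′≈w : ∀ {x y u v w u′ v′} → x + y ≈ (u + v) + w →
    u + u′ ≈ 0# → v + v′ ≈ 0# → x + (u′ + (y + v′)) ≈ w
  x+y≈u+v+w⇒x+u′+y+v′≈w {x} {y} {u} {v} {w} {u′} {v′} x+y≈u+v+w u+u′≈0 v+v′≈0 = begin
    x + (u′ + (y + v′))       ≈⟨ solve 4 (λ x y u′ v′ → x :+ (u′ :+ (y :+ v′)) := (x :+ y) :+ (u′ :+ v′)) refl x y u′ v′ ⟩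
    (x + y) + (u′ + v′)       ≈⟨ +-cong x+y≈u+v+w refl ⟩
    ((u + v) + w) + (u′ + v′) ≈⟨ solve 5 (λ u v w u′ v′ → ((u :+ v) :+ w) :+ (u′ :+ v′) := ((u :+ u′) :+ (v :+ v′)) :+ w) refl u v w u′ v′ ⟩
    ((u + u′) + (v + v′)) + w ≈⟨ +-cong (+-cong u+u′≈0 v+v′≈0) refl ⟩
    (0# + 0#) + w             ≈⟨ trans (+-cong (+-identityˡ 0#) refl) (+-identityˡ w) ⟩
    w                         ∎

  IsUnitSquareCombination : ∀ {p n} → Vector (Fin p) n → Carrier → Set (c ⊔ ℓ)
  IsUnitSquareCombination {n = n} coeff x = Σ (Vector Carrier n) λ u →
    (∀ j → IsUnit R (u j)) × (x ≈ sum (λ j → toℕ (coeff j) ×ₙ (u j * u j)))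

  local⇒isUnitSquareCombination : ∀ {m} → IsFpAlgebra (2 ℕ.+ m) R → IsLocal R →
    IsUnit R (2 ×ₙ 1#) → IsUnit R (3 ×ₙ 1#) → ∀ a → IsUnitSquareCombination (signs m) a
  local⇒isUnitSquareCombination {m} fp isLocal u₂ u₃ a = u , isUnit[u] , (begin
    a      ≈⟨ a≈b+b ⟩
    b + b  ≈⟨ x+y≈u+v+w⇒x+u′+y+v′≈w ([b+1+z]²+z²≈[b+z]²+[1+z]²+2b b z) (+[p-1]×≈0# _) (+[p-1]×≈0# _) ⟨
    s₀ * s₀ + (p-1 ×ₙ (s₁ * s₁) + (s₂ * s₂ + p-1 ×ₙ (s₃ * s₃)))
           ≈⟨ +-cong (+-identityʳ _) (+-cong refl (+-cong (+-identityʳ _) (+-identityʳ _))) ⟨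
    sum (λ j → toℕ (signs m j) ×ₙ (u j * u j)) ∎)
    where
    b : Carrier
    b = proj₁ (isUnit[2]⇒half u₂ a)

    a≈b+b : a ≈ b + b
    a≈b+b = proj₂ (isUnit[2]⇒half u₂ a)

    open UnitShift (local⇒unitShift isLocal u₂ u₃ b)

    s₀ s₁ s₂ s₃ : Carrier
    s₀ = b + (1# + z)
    s₁ = b + z
    s₂ = z
    s₃ = 1# + z

    u : Vector Carrier 4
    u = s₀ ∷ s₁ ∷ s₂ ∷ s₃ ∷ []

    isUnit[u] : ∀ j → IsUnit R (u j)
    isUnit[u] zero                   = isUnit[b+1+z]
    isUnit[u] (suc zero)             = isUnit[b+z]
    isUnit[u] (suc (suc zero))       = isUnit[z]
    isUnit[u] (suc (suc (suc zero))) = isUnit[1+z]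

    p-1 : ℕ
    p-1 = toℕ (fromℕ (ℕ.suc m))

    +[p-1]×≈0# : ∀ x → x + p-1 ×ₙ x ≈ 0#
    +[p-1]×≈0# x = trans (+-cong refl (×-congˡ (toℕ-fromℕ (ℕ.suc m)))) (char⇒×≈0# {2 ℕ.+ m} fp x)

module _ {c ℓ r} (A : Fin r → CommutativeRing c ℓ) where

  private
    module Aᵢ (i : Fin r) where
      open CommutativeRing (A i) public
      open RawMonoidDefs +-rawMonoid public using (sum) renaming (_×_ to _×ₙ_)
      open MonoidSum +-monoid public using (sum-cong-≋)
    open CommutativeRing (Π-ring r A) using (Carrier; _≈_; _*_; +-rawMonoid)
    open RawMonoidDefs +-rawMonoid using (sum) renaming (_×_ to _×ₙ_)

  Π-×ₙ-apply : ∀ k f i → Aᵢ._≈_ i ((k ×ₙ f) i) (Aᵢ._×ₙ_ i k (f i))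
  Π-×ₙ-apply ℕ.zero    f i = Aᵢ.refl i
  Π-×ₙ-apply (ℕ.suc k) f i = Aᵢ.+-cong i (Aᵢ.refl i) (Π-×ₙ-apply k f i)

  Π-sum-apply : ∀ {n} (f : Vector Carrier n) i → Aᵢ._≈_ i (sum f i) (Aᵢ.sum i (λ j → f j i))
  Π-sum-apply {ℕ.zero}  f i = Aᵢ.refl i
  Π-sum-apply {ℕ.suc n} f i = Aᵢ.+-cong i (Aᵢ.refl i) (Π-sum-apply (tail f) i)

  Π-isUnit : ∀ {f} → (∀ i → IsUnit (A i) (f i)) → IsUnit (Π-ring r A) f
  Π-isUnit isUnit[f] = (λ i → proj₁ (isUnit[f] i)) , (λ i → proj₂ (isUnit[f] i))

  Π-isUnitSquareCombination : ∀ {p n} (coeff : Vector (Fin p) n) {x} →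
    (∀ i → IsUnitSquareCombination (A i) coeff (x i)) →
    IsUnitSquareCombination (Π-ring r A) coeff x
  Π-isUnitSquareCombination coeff {x} comb =
    u , (λ j → Π-isUnit (λ i → proj₁ (proj₂ (comb i)) j)) , x≈sum
    where
    u : Vector Carrier _
    u j i = proj₁ (comb i) j

    terms : Vector Carrier _
    terms j = toℕ (coeff j) ×ₙ (u j * u j)

    x≈sum : x ≈ sum terms
    x≈sum i = begin
      x i                                                                  ≈⟨ proj₂ (proj₂ (comb i)) ⟩
      Aᵢ.sum i (λ j → Aᵢ._×ₙ_ i (toℕ (coeff j)) (Aᵢ._*_ i (u j i) (u j i)))
        ≈⟨ Aᵢ.sum-cong-≋ i (λ j → Π-×ₙ-apply (toℕ (coeff j)) (u j * u j) i) ⟨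
      Aᵢ.sum i (λ j → terms j i)                                           ≈⟨ Π-sum-apply terms i ⟨
      sum terms i                                                          ∎
      where open SetoidReasoning (Aᵢ.setoid i)

lemmaA1p2 : ∀ {c ℓ} (p : ℕ) → Prime p → 5 ≤ p →
    (r : ℕ) (A : Fin r → CommutativeRing c ℓ) →
    (∀ i → IsFpAlgebra p (A i)) → (∀ i → IsLocal (A i)) →
    SpannedBySquaresOfUnits p (Π-ring r A)
lemmaA1p2 p@(ℕ.suc (ℕ.suc m)) p-prime 5≤p r A fp isLocal x =
  4 , signs m , Π-isUnitSquareCombination A (signs m) (λ i →
    local⇒isUnitSquareCombination (A i) {m} (fp i) (isLocal i)
      (prime⇒isUnit (A i) (fp i) p-prime 2<p) (prime⇒isUnit (A i) (fp i) p-prime 3<p) (x i))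
  where
  2<p : 2 ℕ.< p
  2<p = ≤-trans (s≤s (s≤s (s≤s z≤n))) 5≤p

  3<p : 3 ℕ.< p
  3<p = ≤-trans (s≤s (s≤s (s≤s (s≤s z≤n)))) 5≤p
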